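{- For every integer $N>2$ there exists an unrefinable partition of $N$ into distinct parts; that is, the set $\mathcal{U}_N$ is nonempty.
   Context: A partition of $N$ into distinct parts is a sequence $\lambda=(\lambda_1,\ldots,\lambda_t)$ of positive integers with $\lambda_1<\cdots<\lambda_t$, $t\ge 2$, and $\lambda_1+\cdots+\lambda_t=N$. Its set of missing parts is $\mathcal{M}_\lambda=\{1,\ldots,\lambda_t\}\setminus\{\lambda_1,\ldots,\lambda_t\}$. $\lambda$ is refinable if some part equals a sum of at least two pairwise distinct missing parts, and unrefinable otherwise. $\mathcal{U}_N$ denotes the set of unrefinable partitions of $N$ into distinct parts. -}

module Defs where

open import Data.Nat using (ℕ; _<_; _≤_; _⊔_; zero; suc)
open import Data.List using (List; length; foldr)
open import Data.Nat.ListAction using (sum)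
open import Data.List.Membership.Propositional using (_∈_; _∉_)
open import Data.List.Relation.Unary.All using (All)
open import Data.List.Relation.Unary.AllPairs using (AllPairs)
open import Data.Product using (Σ; _×_; ∃)
open import Relation.Binary.PropositionalEquality using (_≡_)
open import Relation.Nullary using (¬_)

record DistinctPartition (N : ℕ) : Set where
  field
    parts      : List ℕ
    increasing : AllPairs _<_ parts
    positive   : All (λ x → 0 < x) parts
    atLeastTwo : 2 ≤ length parts
    sumIsN     : sum parts ≡ N

-- Largest part λₜ (the maximum of the parts; equals the last part
-- of a strictly increasing list).
largestPart : List ℕ → ℕ
largestPart = foldr _⊔_ 0

IsMissing : List ℕ → ℕ → Set
IsMissing ps m = 1 ≤ m × m ≤ largestPart ps × m ∉ ps

Refinable : List ℕ → Set
Refinable ps =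
  Σ ℕ λ p → p ∈ ps ×
    Σ (List ℕ) λ S → AllPairs _<_ S × All (IsMissing ps) S
                   × 2 ≤ length S × sum S ≡ p

Unrefinable : List ℕ → Set
Unrefinable ps = ¬ Refinable ps

IsUnrefinablePartition : (N : ℕ) → DistinctPartition N → Set
IsUnrefinablePartition N π = Unrefinable (DistinctPartition.parts π)

-- Take the staircase 1, 2, …, k, m with k < m ≤ 2k + 2.  Every missing part
-- exceeds k, so two distinct missing parts add up to at least
-- (k + 1) + (k + 2) = 2k + 3, beyond the largest part m: the staircase is
-- unrefinable.  Its sum k(k+1)/2 + m runs through all N ≥ 3 as (k, m) varies.
module Submission where

open import Defs
open import Data.Nat using (ℕ; zero; suc; _+_; _<_; _≤_; z≤n; s≤s; z<s)
open import Data.Nat.Properties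
open import Data.Nat.ListAction using (sum)
open import Data.Nat.ListAction.Properties using (sum-++)
open import Data.List using (List; []; _∷_; _∷ʳ_; applyUpTo; length)
open import Data.List.Properties using (applyUpTo-∷ʳ; length-++-≤ʳ)
open import Data.List.Membership.Propositional using (_∈_)
open import Data.List.Membership.Propositional.Properties using (∈-++⁺ˡ; ∈-applyUpTo⁺)
open import Data.List.Relation.Unary.All as All using (All; []; _∷_)
import Data.List.Relation.Unary.All.Properties as All
open import Data.List.Relation.Unary.AllPairs using (AllPairs; []; _∷_)
import Data.List.Relation.Unary.AllPairs.Properties as AllPairs
open import Data.Product using (Σ; _,_)
open import Data.Sum using (inj₁; inj₂)
open import Function using (_∘_)
open import Relation.Binary.PropositionalEquality using (_≡_; refl; sym; trans; cong; subst; module ≡-Reasoning)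

private
  variable
    k m N : ℕ
    ps : List ℕ

sum-∷ʳ : ∀ xs x → sum (xs ∷ʳ x) ≡ sum xs + x
sum-∷ʳ xs x = trans (sum-++ xs (x ∷ [])) (cong (sum xs +_) (+-identityʳ x))

missing-above : (∀ {s} → 1 ≤ s → s ≤ k → s ∈ ps) → ∀ {s} → IsMissing ps s → k < s
missing-above initial (1≤s , _ , s∉ps) = ≰⇒> (λ s≤k → s∉ps (initial 1≤s s≤k))

sum-distinct-above : ∀ {S} → AllPairs _<_ S → All (k <_) S → 2 ≤ length S →
                     suc k + suc (suc k) ≤ sum S
sum-distinct-above {k} {s₁ ∷ s₂ ∷ rest} ((s₁<s₂ ∷ _) ∷ _) (k<s₁ ∷ _) _ = begin
  suc k + suc (suc k) ≤⟨ +-mono-≤ k<s₁ (≤-trans (s≤s k<s₁) s₁<s₂) ⟩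
  s₁ + s₂             ≤⟨ +-monoʳ-≤ s₁ (m≤m+n s₂ (sum rest)) ⟩
  s₁ + (s₂ + sum rest) ∎
  where open ≤-Reasoning
sum-distinct-above {S = _ ∷ []} _ _ (s≤s ())

unrefinable-⊇initialSegment : (∀ {s} → 1 ≤ s → s ≤ k → s ∈ ps) →
                              All (_< suc k + suc (suc k)) ps → Unrefinable ps
unrefinable-⊇initialSegment initial below
  (p , p∈ps , S , S-increasing , S-missing , 2≤|S| , ΣS≡p) =
  <⇒≱ (All.lookup below p∈ps)
      (subst (_ ≤_) ΣS≡p
        (sum-distinct-above S-increasing (All.map (missing-above initial) S-missing) 2≤|S|))

triangular : ℕ → ℕ
triangular k = sum (applyUpTo suc k)

triangular-suc : ∀ k → triangular (suc k) ≡ triangular k + suc k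
triangular-suc k = trans (cong sum (sym (applyUpTo-∷ʳ suc k))) (sum-∷ʳ (applyUpTo suc k) (suc k))

staircase : ℕ → ℕ → List ℕ
staircase k m = applyUpTo suc k ∷ʳ m

staircase-increasing : k < m → AllPairs _<_ (staircase k m)
staircase-increasing {k} k<m = AllPairs.++⁺
  (AllPairs.applyUpTo⁺₁ suc k (λ i<j _ → s≤s i<j))
  ([] ∷ [])
  (All.applyUpTo⁺₁ suc k (λ i<k → ≤-trans (s≤s i<k) k<m ∷ []))

staircase-positive : k < m → All (0 <_) (staircase k m)
staircase-positive {k} k<m = All.++⁺ (All.applyUpTo⁺₂ suc k (λ _ → z<s)) (≤-<-trans z≤n k<m ∷ [])

staircase-bounded : k < m → All (_≤ m) (staircase k m)
staircase-bounded {k} k<m = All.++⁺ (All.applyUpTo⁺₁ suc k (λ i<k → ≤-trans i<k (<⇒≤ k<m))) (≤-refl ∷ [])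

staircase-length : 1 ≤ k → 2 ≤ length (staircase k m)
staircase-length {suc j} {m} _ = s≤s (length-++-≤ʳ (m ∷ []) {applyUpTo (suc ∘ suc) j})

staircase-sum : ∀ k m → sum (staircase k m) ≡ triangular k + m
staircase-sum k = sum-∷ʳ (applyUpTo suc k)

staircase-⊇initialSegment : ∀ {s} → 1 ≤ s → s ≤ k → s ∈ staircase k m
staircase-⊇initialSegment {s = suc i} _ i<k = ∈-++⁺ˡ (∈-applyUpTo⁺ suc i<k)

record StaircaseOf (N : ℕ) : Set where
  field
    steps top    : ℕ
    1≤steps      : 1 ≤ steps
    steps<top    : steps < top
    top<limit    : top < suc steps + suc (suc steps)
    triangular+≡ : triangular steps + top ≡ N

staircaseOf-suc : StaircaseOf N → StaircaseOf (suc N)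
staircaseOf-suc {N} s with m≤n⇒m<n∨m≡n (StaircaseOf.top<limit s)
... | inj₁ top+1<limit = record
  { steps = steps ; top = suc top
  ; 1≤steps = 1≤steps ; steps<top = m≤n⇒m≤1+n steps<top ; top<limit = top+1<limit
  ; triangular+≡ = trans (+-suc (triangular steps) top) (cong suc triangular+≡) }
  where open StaircaseOf s
... | inj₂ top+1≡limit = record
  { steps = suc steps ; top = suc (suc steps)
  ; 1≤steps = s≤s z≤n ; steps<top = ≤-refl ; top<limit = m<m+n _ z<s
  ; triangular+≡ = begin
      triangular (suc steps) + suc (suc steps)         ≡⟨ cong (_+ suc (suc steps)) (triangular-suc steps) ⟩
      triangular steps + suc steps + suc (suc steps)   ≡⟨ +-assoc (triangular steps) _ _ ⟩
      triangular steps + (suc steps + suc (suc steps)) ≡⟨ cong (triangular steps +_) top+1≡limit ⟨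
      triangular steps + suc top                       ≡⟨ +-suc (triangular steps) top ⟩
      suc (triangular steps + top)                     ≡⟨ cong suc triangular+≡ ⟩
      suc N                                            ∎ }
  where
  open StaircaseOf s
  open ≡-Reasoning

staircaseOf-3+ : ∀ n → StaircaseOf (3 + n)
staircaseOf-3+ zero = record
  { steps = 1 ; top = 2 ; 1≤steps = ≤-refl ; steps<top = ≤-refl
  ; top<limit = s≤s (s≤s (s≤s z≤n)) ; triangular+≡ = refl }
staircaseOf-3+ (suc n) = staircaseOf-suc (staircaseOf-3+ n)

unrefinablePartition : StaircaseOf N → Σ (DistinctPartition N) (IsUnrefinablePartition N)
unrefinablePartition s =
  record
    { parts      = staircase steps top
    ; increasing = staircase-increasing steps<top
    ; positive   = staircase-positive steps<top
    ; atLeastTwo = staircase-length 1≤steps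
    ; sumIsN     = trans (staircase-sum steps top) triangular+≡ }
  , unrefinable-⊇initialSegment staircase-⊇initialSegment
      (All.map (λ p≤top → ≤-<-trans p≤top top<limit) (staircase-bounded steps<top))
  where open StaircaseOf s

mainTheorem11 : (N : ℕ) → 2 < N → Σ (DistinctPartition N) (IsUnrefinablePartition N)
mainTheorem11 (suc (suc (suc n))) _ = unrefinablePartition (staircaseOf-3+ n)
mainTheorem11 (suc zero) (s≤s ())
mainTheorem11 (suc (suc zero)) (s≤s (s≤s ()))
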